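{- Let $K$ be a set and for each $k\in K$ let $P_k=(I_k\xleftarrow{n_k}D_k\xrightarrow{d_k}A_k\xrightarrow{a_k}I_k)$ be a polynomial in $\mathbf{Set}$. The polynomial $$\bigoplus_{k\in K}P_k=\Big(\coprod_k I_k\xleftarrow{\coprod_k n_k}\coprod_k D_k\xrightarrow{\coprod_k d_k}\coprod_k A_k\xrightarrow{\coprod_k a_k}\coprod_k I_k\Big)$$ is both the cartesian product and the coproduct of the polynomials $P_k$ in $\mathsf{PE}_{\mathbf{Set}}$.
   Context: A polynomial over a set $I$ is a diagram of functions $I\xleftarrow{n}D\xrightarrow{d}A\xrightarrow{a}I$. A simulation from $P_1=(I_1\xleftarrow{n_1}D_1\xrightarrow{d_1}A_1\xrightarrow{a_1}I_1)$ to $P_2=(I_2\xleftarrow{n_2}D_2\xrightarrow{d_2}A_2\xrightarrow{a_2}I_2)$ consists of: a span $I_1\xleftarrow{r_1}R\xrightarrow{r_2}I_2$; writing $R\cdot A_1$ for the pullback of $a_1$ along $r_1$ (projections $x$ to $R$, $y$ to $A_1$), a function $\alpha:R\cdot A_1\to A_2$ with $a_2\alpha=r_2x$; writing $R\cdot D_2$ for the pullback of $d_2$ along $\alpha$ (projections $p$, $q$ to $R\cdot A_1$, $D_2$), functions $\beta:R\cdot D_2\to D_1$, $\gamma:R\cdot D_2\to R$ with $d_1\beta=yp$, $n_1\beta=r_1\gamma$, $n_2q=r_2\gamma$. Simulations are identified when there is an isomorphism of spans transporting $\alpha,\beta,\gamma$. Composition: span $R\times_{I_2}R'$, $\alpha''(r,r',a_1)=\alpha'(r',\alpha(r,a_1))$,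 and for $d_3$ over $\alpha''$, with $d_2=\beta'(r',\alpha(r,a_1),d_3)$, $\beta''=\beta(r,a_1,d_2)$, $\gamma''=(\gamma(r,a_1,d_2),\gamma'(r',\alpha(r,a_1),d_3))$; identities have span $I\xleftarrow{1}I\xrightarrow{1}I$, $\alpha=1$, $\beta=1$, $\gamma=n$. $\mathsf{PE}_{\mathbf{Set}}$ has polynomials as objects and equivalence classes of simulations as morphisms. -}

module Defs where

open import Level using (0ℓ)
open import Data.Product using (Σ; _×_; _,_; proj₁; proj₂)
open import Relation.Binary.PropositionalEquality using (_≡_; refl; sym; trans; cong)

record Poly : Set₁ where
  field
    I D A : Set
    n : D → I
    d : D → A
    a : A → I
open Poly

record Pullback {X Y Z : Set} (f : X → Z) (g : Y → Z) : Set where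
  constructor pb
  field
    fst : X
    snd : Y
    eq  : f fst ≡ g snd
open Pullback

-- A simulation P₁ → P₂.
--   R·A₁ = Pullback r₁ (a P₁)   (projections x = fst, y = snd)
--   R·D₂ = Pullback α (d P₂)    (projections p = fst, q = snd)
record Sim (P₁ P₂ : Poly) : Set₁ where
  field
    R   : Set
    r₁  : R → I P₁
    r₂  : R → I P₂
    α   : Pullback r₁ (a P₁) → A P₂
    α-ok : ∀ u → a P₂ (α u) ≡ r₂ (fst u)
    β   : Pullback α (d P₂) → D P₁
    γ   : Pullback α (d P₂) → R
    β-ok₁ : ∀ v → d P₁ (β v) ≡ snd (fst v)
    β-ok₂ : ∀ v → n P₁ (β v) ≡ r₁ (γ v)
    γ-ok  : ∀ v → n P₂ (snd v) ≡ r₂ (γ v)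
open Sim

record _≈S_ {P₁ P₂ : Poly} (S T : Sim P₁ P₂) : Set where
  field
    to   : R S → R T
    from : R T → R S
    from-to : ∀ r → from (to r) ≡ r
    to-from : ∀ r → to (from r) ≡ r
    r₁-comm : ∀ r → r₁ T (to r) ≡ r₁ S r
    r₂-comm : ∀ r → r₂ T (to r) ≡ r₂ S r
  trA : Pullback (r₁ S) (a P₁) → Pullback (r₁ T) (a P₁)
  trA (pb r x e) = pb (to r) x (trans (r₁-comm r) e)
  field
    α-comm : ∀ u → α T (trA u) ≡ α S u
  trD : Pullback (α S) (d P₂) → Pullback (α T) (d P₂)
  trD (pb u z e) = pb (trA u) z (trans (α-comm u) e)
  field
    β-comm : ∀ v → β T (trD v) ≡ β S v
    γ-comm : ∀ v → γ T (trD v) ≡ to (γ S v)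

_∘S_ : {P₁ P₂ P₃ : Poly} → Sim P₂ P₃ → Sim P₁ P₂ → Sim P₁ P₃
_∘S_ {P₁} {P₂} {P₃} T S = record
  { R = R''
  ; r₁ = λ w → r₁ S (fst w)
  ; r₂ = λ w → r₂ T (snd w)
  ; α = α''
  ; α-ok = λ u → α-ok T (mid u)
  ; β = β''
  ; γ = γ''
  ; β-ok₁ = λ v → β-ok₁ S (inner v)
  ; β-ok₂ = λ v → β-ok₂ S (inner v)
  ; γ-ok = λ v → γ-ok T (outer v)
  }
  where
  R'' : Set
  R'' = Pullback (r₂ S) (r₁ T)
  first : Pullback (λ w → r₁ S (fst w)) (a P₁) → Pullback (r₁ S) (a P₁)
  first (pb w x e) = pb (fst w) x e
  mid : Pullback (λ w → r₁ S (fst w)) (a P₁) → Pullback (r₁ T) (a P₂)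
  mid u = pb (snd (fst u)) (α S (first u))
             (trans (sym (eq (fst u))) (sym (α-ok S (first u))))
  α'' : Pullback (λ w → r₁ S (fst w)) (a P₁) → A P₃
  α'' u = α T (mid u)
  outer : Pullback α'' (d P₃) → Pullback (α T) (d P₃)
  outer (pb u z e) = pb (mid u) z e
  inner : Pullback α'' (d P₃) → Pullback (α S) (d P₂)
  inner v = pb (first (fst v)) (β T (outer v)) (sym (β-ok₁ T (outer v)))
  β'' : Pullback α'' (d P₃) → D P₁
  β'' v = β S (inner v)
  γ'' : Pullback α'' (d P₃) → R''
  γ'' v = pb (γ S (inner v)) (γ T (outer v))
             (trans (sym (γ-ok S (inner v))) (β-ok₂ T (outer v)))

⊕ : (K : Set) → (K → Poly) → Poly
⊕ K P = record
  { I = Σ K (λ k → I (P k))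
  ; D = Σ K (λ k → D (P k))
  ; A = Σ K (λ k → A (P k))
  ; n = λ { (k , x) → k , n (P k) x }
  ; d = λ { (k , x) → k , d (P k) x }
  ; a = λ { (k , x) → k , a (P k) x }
  }

-- X with projections π is a product of the family P in PE_Set
-- (morphisms are simulations up to ≈S).
IsProduct : (K : Set) (P : K → Poly) (X : Poly) (π : (k : K) → Sim X (P k)) → Set₁
IsProduct K P X π =
  (Q : Poly) (f : (k : K) → Sim Q (P k)) →
  Σ (Sim Q X) λ u →
    ((k : K) → (π k ∘S u) ≈S f k) ×
    ((v : Sim Q X) → ((k : K) → (π k ∘S v) ≈S f k) → v ≈S u)

IsCoproduct : (K : Set) (P : K → Poly) (X : Poly) (ι : (k : K) → Sim (P k) X) → Set₁
IsCoproduct K P X ι =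
  (Q : Poly) (f : (k : K) → Sim (P k) Q) →
  Σ (Sim X Q) λ u →
    ((k : K) → (u ∘S ι k) ≈S f k) ×
    ((v : Sim X Q) → ((k : K) → (v ∘S ι k) ≈S f k) → v ≈S u)

-- Everything in ⊕ₖ Pₖ lives over an index k : K, and all its structure maps
-- preserve that index.  Hence a simulation into (resp. out of) ⊕ₖ Pₖ splits
-- its span R as Σₖ Rₖ along the index of r₂ (resp. r₁), and the pieces are
-- precisely simulations into Pₖ (resp. out of Pₖ).  Concretely:
--   * the projection πₖ : ⊕ P → Pₖ and injection ιₖ : Pₖ → ⊕ P both have
--     span Iₖ, with the coproduct inclusion on the ⊕-side;
--   * the pairing ⟨fₖ⟩ and copairing [gₖ] have span Σₖ R(fₖ) (resp. R(gₖ))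
--     and act as fₖ (resp. gₖ) on the k-th summand;
--   * for uniqueness, a simulation V with πₖ ∘ V ≈ fₖ (resp. V ∘ ιₖ ≈ gₖ) is
--     compared with the (co)pairing via R V ≅ Σₖ R(πₖ ∘ V) ≅ Σₖ R(fₖ).
module Submission where

open import Defs
open import Axiom.UniquenessOfIdentityProofs.WithK using (uip)
open import Data.Product using (Σ; _×_; _,_; proj₁; proj₂; map₂)
open import Relation.Binary.PropositionalEquality using (_≡_; refl; sym; trans; cong)
open Poly
open Pullback
open Sim

-- Elements of a pullback are determined by their two components, since the
-- equation component is a proof of an equality (uniqueness of identity proofs).
pullback-≡ : {X Y Z : Set} {f : X → Z} {g : Y → Z} {p q : Pullback f g} →
             fst p ≡ fst q → snd p ≡ snd q → p ≡ q
pullback-≡ {p = pb x y e} {pb .x .y e'} refl refl = cong (pb x y) (uip e e')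

-- This is
-- what makes the splitting R ≅ Σₖ Rₖ of a span independent of the witness.
index-determined : {K : Set} {C Z : K → Set} (y : Σ K C)
                   (F : (k : K) (c : C k) → y ≡ (k , c) → Z k) →
                   (k : K) (c : C k) (p : y ≡ (k , c)) →
                   (proj₁ y , F (proj₁ y) (proj₂ y) refl) ≡ (k , F k c p)
index-determined y F k c refl = refl

-- This is how positions and directions of ⊕ P over the k-th summand
-- are read as positions and directions of Pₖ.
module Fibrewise {K : Set} {B C : K → Set} (g : (k : K) → B k → C k) where

  lift : {k : K} {c : C k} (z : Σ K B) → (k , c) ≡ map₂ (g _) z →
         Σ (B k) (λ b → c ≡ g k b)
  lift (k , b) refl = b , refl

  lift-point : {k : K} {c : C k} (z : Σ K B) (e : (k , c) ≡ map₂ (g _) z) →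
               (k , proj₁ (lift z e)) ≡ z
  lift-point (k , b) refl = refl

  lift-β : {k : K} {c : C k} (b : B k) (e : (k , c) ≡ (k , g k b)) →
           proj₁ (lift (k , b) e) ≡ b
  lift-β b refl = refl

-- The intermediate maps of the composite T ∘S S from Defs (there they are
-- local to a where-block), needed to state the components of T ∘S S:
--   ∘-mid   : R''·A₁ → R_T·A₂,   u ↦ (r' , α_S(r , a₁))
--   ∘-outer : R''·D₃ → R_T·D₃,   ∘-inner : R''·D₃ → R_S·D₂,
--   ∘-γ     : the γ-component of the composite.
module _ {P₁ P₂ P₃ : Poly} (T : Sim P₂ P₃) (S : Sim P₁ P₂) where
  private
    first : Pullback (λ (w : Pullback (r₂ S) (r₁ T)) → r₁ S (fst w)) (a P₁) →
            Pullback (r₁ S) (a P₁)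
    first (pb w x e) = pb (fst w) x e

  ∘-mid : Pullback (λ (w : Pullback (r₂ S) (r₁ T)) → r₁ S (fst w)) (a P₁) →
          Pullback (r₁ T) (a P₂)
  ∘-mid u = pb (snd (fst u)) (α S (first u))
               (trans (sym (eq (fst u))) (sym (α-ok S (first u))))

  ∘-outer : Pullback (α (T ∘S S)) (d P₃) → Pullback (α T) (d P₃)
  ∘-outer (pb u z e) = pb (∘-mid u) z e

  ∘-inner : Pullback (α (T ∘S S)) (d P₃) → Pullback (α S) (d P₂)
  ∘-inner v = pb (first (fst v)) (β T (∘-outer v)) (sym (β-ok₁ T (∘-outer v)))

  ∘-γ : Pullback (α (T ∘S S)) (d P₃) → R (T ∘S S)
  ∘-γ v = pb (γ S (∘-inner v)) (γ T (∘-outer v))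
             (trans (sym (γ-ok S (∘-inner v))) (β-ok₂ T (∘-outer v)))

module DirectSum (K : Set) (P : K → Poly) where
  X : Poly
  X = ⊕ K P

  open Fibrewise (λ k → d (P k)) using ()
    renaming (lift to liftD; lift-point to liftD-point; lift-β to liftD-β)
  open Fibrewise (λ k → a (P k)) using ()
    renaming (lift to liftA; lift-point to liftA-point; lift-β to liftA-β)

  π-α : (k : K) → Pullback (λ i → (k , i)) (a X) → A (P k)
  π-α k (pb i y e) = proj₁ (liftA y e)

  π : (k : K) → Sim X (P k)
  π k = record
    { R = I (P k) ; r₁ = λ i → k , i ; r₂ = λ i → i
    ; α = π-α k ; α-ok = λ u → sym (proj₂ (liftA (snd u) (eq u)))
    ; β = λ v → k , snd v ; γ = λ v → n (P k) (snd v)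
    ; β-ok₁ = λ v → trans (cong (k ,_) (sym (eq v)))
                          (liftA-point (snd (fst v)) (eq (fst v)))
    ; β-ok₂ = λ v → refl ; γ-ok = λ v → refl }

  ι-β : (k : K) → Pullback (λ (u : Pullback (λ i → i) (a (P k))) → (k , snd u)) (d X) →
        D (P k)
  ι-β k (pb u z e) = proj₁ (liftD z e)

  ι : (k : K) → Sim (P k) X
  ι k = record
    { R = I (P k) ; r₁ = λ i → i ; r₂ = λ i → k , i
    ; α = λ u → k , snd u ; α-ok = λ u → cong (k ,_) (sym (eq u))
    ; β = ι-β k ; γ = λ v → n (P k) (ι-β k v)
    ; β-ok₁ = λ v → sym (proj₂ (liftD (snd v) (eq v)))
    ; β-ok₂ = λ v → refl
    ; γ-ok = λ v → cong (n X) (sym (liftD-point (snd v) (eq v))) }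

  module Pairing (Q : Poly) (f : (k : K) → Sim Q (P k)) where
    R⟨f⟩ : Set
    R⟨f⟩ = Σ K (λ k → R (f k))

    r₁⟨f⟩ : R⟨f⟩ → I Q
    r₁⟨f⟩ (k , s) = r₁ (f k) s

    r₂⟨f⟩ : R⟨f⟩ → I X
    r₂⟨f⟩ (k , s) = k , r₂ (f k) s

    α⟨f⟩ : Pullback r₁⟨f⟩ (a Q) → A X
    α⟨f⟩ (pb (k , s) x e) = k , α (f k) (pb s x e)

    direction : (k : K) (s : R (f k)) (x : A Q) (e : r₁ (f k) s ≡ a Q x)
                (z : D X) → (k , α (f k) (pb s x e)) ≡ d X z →
                Pullback (α (f k)) (d (P k))
    direction k s x e z ez = pb (pb s x e) (proj₁ (liftD z ez)) (proj₂ (liftD z ez))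

    β⟨f⟩ : Pullback α⟨f⟩ (d X) → D Q
    β⟨f⟩ (pb (pb (k , s) x e) z ez) = β (f k) (direction k s x e z ez)

    γ⟨f⟩ : Pullback α⟨f⟩ (d X) → R⟨f⟩
    γ⟨f⟩ (pb (pb (k , s) x e) z ez) = k , γ (f k) (direction k s x e z ez)

    ⟨f⟩ : Sim Q X
    ⟨f⟩ = record
      { R = R⟨f⟩ ; r₁ = r₁⟨f⟩ ; r₂ = r₂⟨f⟩ ; α = α⟨f⟩
      ; α-ok = λ { (pb (k , s) x e) → cong (k ,_) (α-ok (f k) (pb s x e)) }
      ; β = β⟨f⟩ ; γ = γ⟨f⟩
      ; β-ok₁ = λ { (pb (pb (k , s) x e) z ez) → β-ok₁ (f k) (direction k s x e z ez) }
      ; β-ok₂ = λ { (pb (pb (k , s) x e) z ez) → β-ok₂ (f k) (direction k s x e z ez) }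
      ; γ-ok = λ { (pb (pb (k , s) x e) z ez) →
                     trans (cong (n X) (sym (liftD-point z ez)))
                           (cong (k ,_) (γ-ok (f k) (direction k s x e z ez))) } }

    module _ (k : K) where
      summand : Pullback r₂⟨f⟩ (λ i → k , i) → R (f k)
      summand (pb (k' , s) i refl) = s

      summand-β : (s : R (f k)) (i : I (P k)) (p : r₂⟨f⟩ (k , s) ≡ (k , i)) →
                  summand (pb (k , s) i p) ≡ s
      summand-β s i refl = refl

      projection-pairing : (π k ∘S ⟨f⟩) ≈S f k
      projection-pairing = record
        { to = summand
        ; from = λ s → pb (k , s) (r₂ (f k) s) refl
        ; from-to = λ { (pb (k' , s) i refl) → refl }
        ; to-from = λ s → refl
        ; r₁-comm = λ { (pb (k' , s) i refl) → refl }
        ; r₂-comm = λ { (pb (k' , s) i refl) → refl }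
        ; α-comm = λ { u@(pb (pb (k' , s) i refl) x e) →
            sym (liftA-β (α (f k) (pb s x e)) (eq (∘-mid (π k) ⟨f⟩ u))) }
        ; β-comm = λ { v@(pb (pb (pb (k' , s) i refl) x e) z ez) →
            cong (β (f k)) (pullback-≡ refl (sym (liftD-β z (eq (∘-inner (π k) ⟨f⟩ v))))) }
        ; γ-comm = λ { v@(pb (pb (pb (k' , s) i refl) x e) z ez) →
            trans (cong (γ (f k)) (pullback-≡ refl (sym (liftD-β z (eq (∘-inner (π k) ⟨f⟩ v))))))
                  (sym (summand-β _ _ (eq (∘-γ (π k) ⟨f⟩ v)))) }
        }

    -- An element r of the
    -- span of V lies in the summand of the index of r₂ V r, and the given
    -- equivalences identify that summand with R(fₖ).
    module Unique (V : Sim Q X) (E : (k : K) → (π k ∘S V) ≈S f k) where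
      module Eₖ (k : K) = _≈S_ (E k)

      index : R V → K
      index r = proj₁ (r₂ V r)

      in-summand : (r : R V) → Pullback (r₂ V) (r₁ (π (index r)))
      in-summand r = pb r (proj₂ (r₂ V r)) refl

      split : R V → R⟨f⟩
      split r = index r , Eₖ.to (index r) (in-summand r)

      unsplit : R⟨f⟩ → R V
      unsplit (k , s) = fst (Eₖ.from k s)

      split-at : (r : R V) (k : K) (i : I (P k)) (p : r₂ V r ≡ (k , i)) →
                 split r ≡ (k , Eₖ.to k (pb r i p))
      split-at r = index-determined (r₂ V r) (λ k i p → Eₖ.to k (pb r i p))

      split-r₁ : (r : R V) → r₁⟨f⟩ (split r) ≡ r₁ V r
      split-r₁ r = Eₖ.r₁-comm (index r) (in-summand r)

      split-r₂ : (r : R V) → r₂⟨f⟩ (split r) ≡ r₂ V r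
      split-r₂ r = cong (index r ,_) (Eₖ.r₂-comm (index r) (in-summand r))

      position : (u : Pullback (r₁ V) (a Q)) →
                 Pullback (λ (w : Pullback (r₂ V) (r₁ (π (index (fst u))))) → r₁ V (fst w)) (a Q)
      position u = pb (in-summand (fst u)) (snd u) (eq u)

      α-summand : (u : Pullback (r₁ V) (a Q)) →
                  α (f (index (fst u)))
                    (pb (Eₖ.to (index (fst u)) (in-summand (fst u))) (snd u)
                        (trans (split-r₁ (fst u)) (eq u)))
                  ≡ π-α (index (fst u)) (∘-mid (π (index (fst u))) V (position u))
      α-summand u = trans (cong (α (f (index (fst u)))) (pullback-≡ refl refl))
                          (Eₖ.α-comm (index (fst u)) (position u))

      split-α : (u : Pullback (r₁ V) (a Q)) →
                α⟨f⟩ (pb (split (fst u)) (snd u) (trans (split-r₁ (fst u)) (eq u))) ≡ α V u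
      split-α u =
        trans (cong (index (fst u) ,_) (α-summand u))
              (liftA-point (α V u) (eq (∘-mid (π (index (fst u))) V (position u))))

      module _ (v : Pullback (α V) (d X)) where
        private
          u = fst v
          r = fst u
          k = index r
          ez = trans (split-α u) (eq v)
          z = proj₁ (liftD (snd v) ez)
          v' : Pullback (α (π k ∘S V)) (d (P k))
          v' = pb (position u) z (trans (sym (α-summand u)) (proj₂ (liftD (snd v) ez)))
          lifted : (k , z) ≡ snd v
          lifted = liftD-point (snd v) ez

        split-β : β⟨f⟩ (pb (pb (split r) (snd u) (trans (split-r₁ r) (eq u))) (snd v) ez) ≡ β V v
        split-β = trans (cong (β (f k)) (pullback-≡ (pullback-≡ refl refl) refl))
                        (trans (Eₖ.β-comm k v') (cong (β V) (pullback-≡ refl lifted)))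

        split-γ : γ⟨f⟩ (pb (pb (split r) (snd u) (trans (split-r₁ r) (eq u))) (snd v) ez) ≡
                  split (γ V v)
        split-γ =
          trans (cong (k ,_)
                  (trans (cong (γ (f k)) (pullback-≡ (pullback-≡ refl refl) refl))
                         (trans (Eₖ.γ-comm k v')
                                (cong (Eₖ.to k) (pullback-≡ (cong (γ V) (pullback-≡ refl lifted)) refl)))))
                (sym (split-at (γ V v) k (n (P k) z)
                       (trans (sym (γ-ok V v)) (cong (n X) (sym lifted)))))

      pairing-unique : V ≈S ⟨f⟩
      pairing-unique = record
        { to = split ; from = unsplit
        ; from-to = λ r → cong fst (Eₖ.from-to (index r) (in-summand r))
        ; to-from = λ { (k , s) →
            trans (split-at (fst (Eₖ.from k s)) k (snd (Eₖ.from k s)) (eq (Eₖ.from k s)))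
                  (cong (k ,_) (Eₖ.to-from k s)) }
        ; r₁-comm = split-r₁ ; r₂-comm = split-r₂
        ; α-comm = split-α ; β-comm = split-β ; γ-comm = split-γ }

  module Copairing (Q : Poly) (g : (k : K) → Sim (P k) Q) where
    R[g] : Set
    R[g] = Σ K (λ k → R (g k))

    r₁[g] : R[g] → I X
    r₁[g] (k , s) = k , r₁ (g k) s

    r₂[g] : R[g] → I Q
    r₂[g] (k , s) = r₂ (g k) s

    position : (k : K) (s : R (g k)) (y : A X) → (k , r₁ (g k) s) ≡ a X y →
               Pullback (r₁ (g k)) (a (P k))
    position k s y e = pb s (proj₁ (liftA y e)) (proj₂ (liftA y e))

    α[g] : Pullback r₁[g] (a X) → A Q
    α[g] (pb (k , s) y e) = α (g k) (position k s y e)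

    β[g] : Pullback α[g] (d Q) → D X
    β[g] (pb (pb (k , s) y e) z ez) = k , β (g k) (pb (position k s y e) z ez)

    γ[g] : Pullback α[g] (d Q) → R[g]
    γ[g] (pb (pb (k , s) y e) z ez) = k , γ (g k) (pb (position k s y e) z ez)

    [g] : Sim X Q
    [g] = record
      { R = R[g] ; r₁ = r₁[g] ; r₂ = r₂[g] ; α = α[g]
      ; α-ok = λ { (pb (k , s) y e) → α-ok (g k) (position k s y e) }
      ; β = β[g] ; γ = γ[g]
      ; β-ok₁ = λ { (pb (pb (k , s) y e) z ez) →
                      trans (cong (k ,_) (β-ok₁ (g k) (pb (position k s y e) z ez)))
                            (liftA-point y e) }
      ; β-ok₂ = λ { (pb (pb (k , s) y e) z ez) →
                      cong (k ,_) (β-ok₂ (g k) (pb (position k s y e) z ez)) }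
      ; γ-ok = λ { (pb (pb (k , s) y e) z ez) → γ-ok (g k) (pb (position k s y e) z ez) } }

    module _ (k : K) where
      summand : Pullback (λ i → k , i) r₁[g] → R (g k)
      summand (pb i (k' , s) refl) = s

      summand-β : (i : I (P k)) (s : R (g k)) (p : (k , i) ≡ r₁[g] (k , s)) →
                  summand (pb i (k , s) p) ≡ s
      summand-β i s refl = refl

      copairing-injection : ([g] ∘S ι k) ≈S g k
      copairing-injection = record
        { to = summand
        ; from = λ s → pb (r₁ (g k) s) (k , s) refl
        ; from-to = λ { (pb i (k' , s) refl) → refl }
        ; to-from = λ s → refl
        ; r₁-comm = λ { (pb i (k' , s) refl) → refl }
        ; r₂-comm = λ { (pb i (k' , s) refl) → refl }
        ; α-comm = λ { u@(pb (pb i (k' , s) refl) t e) →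
            cong (α (g k)) (pullback-≡ refl (sym (liftA-β t (eq (∘-mid [g] (ι k) u))))) }
        ; β-comm = λ { v@(pb u@(pb (pb i (k' , s) refl) t e) z ez) →
            trans (cong (β (g k))
                        (pullback-≡ (pullback-≡ refl (sym (liftA-β t (eq (∘-mid [g] (ι k) u))))) refl))
                  (sym (liftD-β _ (eq (∘-inner [g] (ι k) v)))) }
        ; γ-comm = λ { v@(pb u@(pb (pb i (k' , s) refl) t e) z ez) →
            trans (cong (γ (g k))
                        (pullback-≡ (pullback-≡ refl (sym (liftA-β t (eq (∘-mid [g] (ι k) u))))) refl))
                  (sym (summand-β _ _ (eq (∘-γ [g] (ι k) v)))) }
        }

    -- Uniqueness: if V ∘ ιₖ ≈ gₖ for all k, then V ≈ [g], splitting the span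
    -- of V along the index of r₁.
    module Unique (V : Sim X Q) (E : (k : K) → (V ∘S ι k) ≈S g k) where
      module Eₖ (k : K) = _≈S_ (E k)

      index : R V → K
      index r = proj₁ (r₁ V r)

      in-summand : (r : R V) → Pullback (r₂ (ι (index r))) (r₁ V)
      in-summand r = pb (proj₂ (r₁ V r)) r refl

      split : R V → R[g]
      split r = index r , Eₖ.to (index r) (in-summand r)

      unsplit : R[g] → R V
      unsplit (k , s) = snd (Eₖ.from k s)

      split-at : (r : R V) (k : K) (i : I (P k)) (p : (k , i) ≡ r₁ V r) →
                 split r ≡ (k , Eₖ.to k (pb i r p))
      split-at r k i p =
        trans (index-determined (r₁ V r) (λ k i q → Eₖ.to k (pb i r (sym q))) k i (sym p))
              (cong (λ w → k , Eₖ.to k w) (pullback-≡ refl refl))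

      split-r₁ : (r : R V) → r₁[g] (split r) ≡ r₁ V r
      split-r₁ r = cong (index r ,_) (Eₖ.r₁-comm (index r) (in-summand r))

      split-r₂ : (r : R V) → r₂[g] (split r) ≡ r₂ V r
      split-r₂ r = Eₖ.r₂-comm (index r) (in-summand r)

      module _ (u : Pullback (r₁ V) (a X)) where
        private
          r = fst u
          k = index r
          e = trans (split-r₁ r) (eq u)
          t = proj₁ (liftA (snd u) e)

        position-in-summand : Pullback (λ (w : Pullback (r₂ (ι k)) (r₁ V)) → r₁ (ι k) (fst w)) (a (P k))
        position-in-summand =
          pb (in-summand r) t (trans (sym (Eₖ.r₁-comm k (in-summand r))) (proj₂ (liftA (snd u) e)))

        position-mid : ∘-mid V (ι k) position-in-summand ≡ u
        position-mid = pullback-≡ refl (liftA-point (snd u) e)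

        split-α : α[g] (pb (split r) (snd u) e) ≡ α V u
        split-α = trans (cong (α (g k)) (pullback-≡ refl refl))
                        (trans (Eₖ.α-comm k position-in-summand) (cong (α V) position-mid))

      module _ (v : Pullback (α V) (d Q)) where
        private
          u = fst v
          r = fst u
          k = index r
          e = trans (split-r₁ r) (eq u)
          ez = trans (split-α u) (eq v)
          v' : Pullback (α (V ∘S ι k)) (d Q)
          v' = pb (position-in-summand u) (snd v) (trans (cong (α V) (position-mid u)) (eq v))
          outer-v' : ∘-outer V (ι k) v' ≡ v
          outer-v' = pullback-≡ (position-mid u) refl

        split-β : β[g] (pb (pb (split r) (snd u) e) (snd v) ez) ≡ β V v
        split-β =
          trans (cong (k ,_) (trans (cong (β (g k)) (pullback-≡ (pullback-≡ refl refl) refl))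
                                    (Eₖ.β-comm k v')))
                (trans (liftD-point _ (eq (∘-inner V (ι k) v'))) (cong (β V) outer-v'))

        split-γ : γ[g] (pb (pb (split r) (snd u) e) (snd v) ez) ≡ split (γ V v)
        split-γ =
          trans (cong (k ,_) (trans (cong (γ (g k)) (pullback-≡ (pullback-≡ refl refl) refl))
                                    (trans (Eₖ.γ-comm k v')
                                           (cong (Eₖ.to k) (pullback-≡ refl (cong (γ V) outer-v'))))))
                (sym (split-at (γ V v) k (γ (ι k) (∘-inner V (ι k) v'))
                       (trans (eq (∘-γ V (ι k) v')) (cong (r₁ V) (cong (γ V) outer-v')))))

      copairing-unique : V ≈S [g]
      copairing-unique = record
        { to = split ; from = unsplit
        ; from-to = λ r → cong snd (Eₖ.from-to (index r) (in-summand r))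
        ; to-from = λ { (k , s) →
            trans (split-at (snd (Eₖ.from k s)) k (fst (Eₖ.from k s)) (eq (Eₖ.from k s)))
                  (cong (k ,_) (Eₖ.to-from k s)) }
        ; r₁-comm = split-r₁ ; r₂-comm = split-r₂
        ; α-comm = split-α ; β-comm = split-β ; γ-comm = split-γ }

  is-product : IsProduct K P X π
  is-product Q f = ⟨f⟩ , projection-pairing , pairing-unique
    where open Pairing Q f
          open Unique using (pairing-unique)

  is-coproduct : IsCoproduct K P X ι
  is-coproduct Q g = [g] , copairing-injection , copairing-unique
    where open Copairing Q g
          open Unique using (copairing-unique)

lemma3p5 : (K : Set) (P : K → Poly) →
    Σ ((k : K) → Sim (⊕ K P) (P k)) (λ π → IsProduct K P (⊕ K P) π) ×
    Σ ((k : K) → Sim (P k) (⊕ K P)) (λ ι → IsCoproduct K P (⊕ K P) ι)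
lemma3p5 K P = (π , is-product) , (ι , is-coproduct)
  where open DirectSum K P
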